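{- Let $\rightarrow_1$ and $\rightarrow_2$ be two orientations on a Fano plane $\mathcal{F}$ with point-set $\mathcal{V}$. Then there exists an automorphism $\sigma$ of $\mathcal{F}$ such that $\sigma(\rightarrow_1)=\ \rightarrow_2$. Consequently, the automorphism groups of the oriented Fano planes $(\mathcal{F},\rightarrow_1)$ and $(\mathcal{F},\rightarrow_2)$ are isomorphic.
   Context: A Fano plane is a pair $(\mathcal{V},\mathcal{B})$ with $|\mathcal{V}|=7$ and $\mathcal{B}$ a collection of 3-subsets (blocks) such that every 2-subset lies in exactly one block; an automorphism is a permutation $\sigma$ of $\mathcal{V}$ with $T\in\mathcal{B}$ iff $\sigma(T)\in\mathcal{B}$. An orientation on $\mathcal{F}$ is an antisymmetric binary relation $\rightarrow$ on $\mathcal{V}$ such that (i) for every block $\{x_1,x_2,x_3\}$, either $x_1\rightarrow x_2\rightarrow x_3\rightarrow x_1$ or $x_1\rightarrow x_3\rightarrow x_2\rightarrow x_1$; (ii) for every $x$, if $\{x,y_i,z_i\}$ ($i=1,2,3$) are the three blocks through $x$ and $x\rightarrow y_i$ for all $i$, then $\{y_1,y_2,y_3\}\in\mathcal{B}$. For an automorphism $\sigma$ of $\mathcal{F}$, $\sigma(\rightarrow)$ is the orientation defined by $\sigma(x)\ \sigma(\rightarrow)\ \sigma(y)$ iff $x\rightarrow y$. An automorphism of the oriented Fano plane $(\mathcal{F},\rightarrow)$ is an automorphism $\sigma$ of $\mathcal{F}$ with $\sigma(\rightarrow)=\ \rightarrow$. -}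

module Defs where

open import Data.Nat using (ℕ)
open import Data.Fin using (Fin)
open import Data.Fin.Subset using (Subset; ⁅_⁆; _∪_; _∈_; ∣_∣)
open import Data.Fin.Permutation using (Permutation′; _⟨$⟩ʳ_; _⟨$⟩ˡ_; _∘ₚ_)
open import Data.Vec using (tabulate; lookup)
open import Data.Product using (Σ; _×_; _,_; ∃)
open import Data.Sum using (_⊎_)
open import Data.Empty using (⊥)
open import Relation.Nullary using (¬_)
open import Relation.Binary.PropositionalEquality using (_≡_; _≢_)
open import Function.Bundles using (_⇔_)

-- The point set 𝒱 is taken to be Fin 7 (any 7-set is a relabelling of it).
Point : Set
Point = Fin 7

Perm : Set
Perm = Permutation′ 7

_≈ₚ_ : Perm → Perm → Set
σ ≈ₚ τ = ∀ x → σ ⟨$⟩ʳ x ≡ τ ⟨$⟩ʳ x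

triple : Point → Point → Point → Subset 7
triple a b c = ⁅ a ⁆ ∪ (⁅ b ⁆ ∪ ⁅ c ⁆)

-- image σ(T) of a subset T under a permutation σ:  i ∈ σ(T) iff σ⁻¹(i) ∈ T
image : Perm → Subset 7 → Subset 7
image σ T = tabulate (λ i → lookup T (σ ⟨$⟩ˡ i))

record FanoPlane : Set₁ where
  field
    Block      : Subset 7 → Set
    block-size : ∀ T → Block T → ∣ T ∣ ≡ 3
    pair-unique : ∀ x y → x ≢ y →
      Σ (Subset 7) λ T → Block T × x ∈ T × y ∈ T ×
        (∀ T′ → Block T′ → x ∈ T′ → y ∈ T′ → T′ ≡ T)
open FanoPlane public

IsAut : FanoPlane → Perm → Set
IsAut F σ = ∀ T → Block F T ⇔ Block F (image σ T)

record IsOrientation (F : FanoPlane) (_⟶_ : Point → Point → Set) : Set where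
  field
    -- antisymmetry (asymmetric reading: x ⟶ y excludes y ⟶ x)
    antisym : ∀ x y → x ⟶ y → ¬ (y ⟶ x)
    cyclic : ∀ x₁ x₂ x₃ → Block F (triple x₁ x₂ x₃) →
      (x₁ ⟶ x₂ × x₂ ⟶ x₃ × x₃ ⟶ x₁) ⊎ (x₁ ⟶ x₃ × x₃ ⟶ x₂ × x₂ ⟶ x₁)
    out-block : ∀ x y₁ z₁ y₂ z₂ y₃ z₃ →
      Block F (triple x y₁ z₁) → Block F (triple x y₂ z₂) → Block F (triple x y₃ z₃) →
      (triple x y₁ z₁) ≢ (triple x y₂ z₂) →
      (triple x y₁ z₁) ≢ (triple x y₃ z₃) →
      (triple x y₂ z₂) ≢ (triple x y₃ z₃) →
      x ⟶ y₁ → x ⟶ y₂ → x ⟶ y₃ →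
      Block F (triple y₁ y₂ y₃)

MapsOrientation : Perm → (Point → Point → Set) → (Point → Point → Set) → Set
MapsOrientation σ _⟶₁_ _⟶₂_ = ∀ x y → (x ⟶₁ y) ⇔ ((σ ⟨$⟩ʳ x) ⟶₂ (σ ⟨$⟩ʳ y))

IsOrientedAut : FanoPlane → (Point → Point → Set) → Perm → Set
IsOrientedAut F _⟶_ σ = IsAut F σ × MapsOrientation σ _⟶_ _⟶_

AutGroupsIsomorphic : FanoPlane → (Point → Point → Set) → (Point → Point → Set) → Set
AutGroupsIsomorphic F _⟶₁_ _⟶₂_ =
  Σ (Perm → Perm) λ φ →
    (∀ σ τ → σ ≈ₚ τ → φ σ ≈ₚ φ τ) ×
    (∀ σ → IsOrientedAut F _⟶₁_ σ → IsOrientedAut F _⟶₂_ (φ σ)) ×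
    (∀ σ τ → IsOrientedAut F _⟶₁_ σ → IsOrientedAut F _⟶₁_ τ →
       φ (σ ∘ₚ τ) ≈ₚ (φ σ ∘ₚ φ τ)) ×
    (∀ σ τ → IsOrientedAut F _⟶₁_ σ → IsOrientedAut F _⟶₁_ τ →
       φ σ ≈ₚ φ τ → σ ≈ₚ τ) ×
    (∀ ρ → IsOrientedAut F _⟶₂_ ρ →
       Σ Perm λ σ → IsOrientedAut F _⟶₁_ σ × φ σ ≈ₚ ρ)

{-# OPTIONS --safe #-}
-- Write x · y for the third point on the line xy. Choose x ⟶ y, x ⟶ z, y ⟶ z with z off the
-- line xy. Since the three lines through x are disjoint apart from x, the seven points x, y, x·y,
-- z, x·z, y·z, x·(y·z) are distinct, hence all points, and counting off the alternatives forces
-- (x·y)·z = x·(y·z): the plane is PG(2, 𝔽₂) in these coordinates. Property (ii) says the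
-- out-neighbours of a point form a line, so x ⟶ y, x ⟶ z give x ⟶ y·z; with the cyclic
-- orientation of each line this forces every arrow. Hence each oriented Fano plane is isomorphic
-- to one fixed standard oriented plane, the two labellings compose to σ, and conjugation by σ
-- identifies the automorphism groups.
module Submission where

open import Defs
import Data.Bool.Properties as Bool
open import Data.Empty using (⊥-elim)
open import Data.Fin.Base using (Fin; zero; suc; punchOut)
open import Data.Fin.Patterns using (0F; 1F; 2F; 3F; 4F; 5F; 6F)
open import Data.Fin.Permutation using (_⟨$⟩ʳ_; _⟨$⟩ˡ_; _∘ₚ_; flip; permutation; inverseˡ; inverseʳ)
open import Data.Fin.Properties using (_≟_; all?; any?; punchOut-injective; injective⇒≤)
open import Data.Fin.Subset using (Subset; ⁅_⁆; _∪_; _∈_; ∣_∣; _⊆_; inside; outside) renaming (⊥ to ∅)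
open import Data.Fin.Subset.Properties
  using (_∈?_; x∈p∪q⁻; x∈p∪q⁺; x∈⁅y⁆⇒x≡y; x∈⁅x⁆; ⊆-antisym; ∣⁅x⁆∣≡1; ∪-assoc; ∪-comm; ∪-idem; ∪-identityˡ; ∪-identityʳ)
open import Data.List.Base using (List; []; _∷_)
open import Data.List.Membership.Propositional using (find) renaming (_∈_ to _∈ₗ_)
open import Data.List.Relation.Unary.All as All using (All; []; _∷_)
open import Data.List.Relation.Unary.Any using (Any) renaming (any? to any?ₗ)
open import Data.Nat.Base as ℕ using (_≤_; _+_; z≤n; s≤s)
import Data.Nat.Properties as ℕ
open import Data.Product using (Σ; ∃; ∃₂; _×_; _,_; proj₁; proj₂)
open import Data.Sum using (_⊎_; inj₁; inj₂; [_,_]′)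
open import Data.Vec.Base using (Vec; []; _∷_; map; foldr; lookup)
open import Data.Vec.Properties using (≡-dec; lookup∘tabulate; tabulate∘lookup; tabulate-cong; []=⇒lookup; lookup⇒[]=)
open import Data.Vec.Relation.Unary.All using ([]; _∷_)
open import Data.List.Membership.DecPropositional {A = Subset 7} (≡-dec Bool._≟_) using () renaming (_∈?_ to _∈ₗ?_)
open import Data.Vec.Relation.Unary.AllPairs using ([]; _∷_)
open import Data.Vec.Relation.Unary.Unique.Propositional using (Unique)
open import Data.Vec.Relation.Unary.Unique.Propositional.Properties using (lookup-injective)
open import Function.Base using (_∘_)
open import Function.Bundles using (_⇔_; mk⇔)
open import Function.Definitions using (Injective)
import Function.Properties.Equivalence as ⇔
open import Relation.Binary.PropositionalEquality
  using (_≡_; _≢_; refl; sym; trans; cong; cong₂; subst; subst₂; ≢-sym; module ≡-Reasoning)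
open import Relation.Nullary using (yes; no; contradiction)
open import Relation.Nullary.Decidable
  using (True; False; toWitness; toWitnessFalse; ¬?; _×-dec_; _⊎-dec_; _→-dec_; from-yes)

injective⇒surjective : ∀ {n} {f : Fin n → Fin n} → Injective _≡_ _≡_ f → ∀ y → ∃ λ x → f x ≡ y
injective⇒surjective {ℕ.suc n} {f} f-injective y with any? (λ x → f x ≟ y)
... | yes found = found
... | no  y∉f   = contradiction (injective⇒≤ punched-injective) ℕ.1+n≰n
  where
  f≢y : ∀ x → y ≢ f x
  f≢y x y≡fx = y∉f (x , sym y≡fx)
  punched-injective : Injective _≡_ _≡_ (λ x → punchOut (f≢y x))
  punched-injective eq = f-injective (punchOut-injective (f≢y _) (f≢y _) eq)

∣p∪q∣≤∣p∣+∣q∣ : ∀ {n} (p q : Subset n) → ∣ p ∪ q ∣ ≤ ∣ p ∣ + ∣ q ∣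
∣p∪q∣≤∣p∣+∣q∣ []            []            = z≤n
∣p∪q∣≤∣p∣+∣q∣ (inside ∷ p)  (inside ∷ q)  =
  s≤s (ℕ.≤-trans (∣p∪q∣≤∣p∣+∣q∣ p q) (ℕ.+-monoʳ-≤ ∣ p ∣ (ℕ.n≤1+n ∣ q ∣)))
∣p∪q∣≤∣p∣+∣q∣ (inside ∷ p)  (outside ∷ q) = s≤s (∣p∪q∣≤∣p∣+∣q∣ p q)
∣p∪q∣≤∣p∣+∣q∣ (outside ∷ p) (inside ∷ q)  =
  ℕ.≤-trans (s≤s (∣p∪q∣≤∣p∣+∣q∣ p q)) (ℕ.≤-reflexive (sym (ℕ.+-suc ∣ p ∣ ∣ q ∣)))
∣p∪q∣≤∣p∣+∣q∣ (outside ∷ p) (outside ∷ q) = ∣p∪q∣≤∣p∣+∣q∣ p q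

fromVec : ∀ {n k} → Vec (Fin n) k → Subset n
fromVec = foldr _ (λ x p → ⁅ x ⁆ ∪ p) ∅

fromVec-map-suc : ∀ {n k} (xs : Vec (Fin n) k) → fromVec (map suc xs) ≡ outside ∷ fromVec xs
fromVec-map-suc []       = refl
fromVec-map-suc (x ∷ xs) = cong (⁅ suc x ⁆ ∪_) (fromVec-map-suc xs)

enumerate : ∀ {n} (p : Subset n) → Σ (Vec (Fin n) ∣ p ∣) λ xs → p ≡ fromVec xs
enumerate [] = [] , refl
enumerate (outside ∷ p) with xs , p≡xs ← enumerate p =
  map suc xs , trans (cong (outside ∷_) p≡xs) (sym (fromVec-map-suc xs))
enumerate (inside ∷ p) with xs , p≡xs ← enumerate p =
  zero ∷ map suc xs , (begin
    inside ∷ p                    ≡⟨ cong (inside ∷_) (trans p≡xs (sym (∪-identityˡ (fromVec xs)))) ⟩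
    inside ∷ (∅ ∪ fromVec xs)     ≡⟨ cong (⁅ zero ⁆ ∪_) (sym (fromVec-map-suc xs)) ⟩
    ⁅ zero ⁆ ∪ fromVec (map suc xs) ∎)
  where open ≡-Reasoning

triple-elim : ∀ {ℓ} (P : Point → Set ℓ) {a b c w} → P a → P b → P c → w ∈ triple a b c → P w
triple-elim P {a} {b} {c} pa pb pc w∈ with x∈p∪q⁻ ⁅ a ⁆ (⁅ b ⁆ ∪ ⁅ c ⁆) w∈
... | inj₁ w∈a = subst P (sym (x∈⁅y⁆⇒x≡y a w∈a)) pa
... | inj₂ w∈bc with x∈p∪q⁻ ⁅ b ⁆ ⁅ c ⁆ w∈bc
...   | inj₁ w∈b = subst P (sym (x∈⁅y⁆⇒x≡y b w∈b)) pb
...   | inj₂ w∈c = subst P (sym (x∈⁅y⁆⇒x≡y c w∈c)) pc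

triple-swap₁₂ : ∀ {a b c} → triple a b c ≡ triple b a c
triple-swap₁₂ {a} {b} {c} = begin
  ⁅ a ⁆ ∪ (⁅ b ⁆ ∪ ⁅ c ⁆) ≡⟨ ∪-assoc ⁅ a ⁆ ⁅ b ⁆ ⁅ c ⁆ ⟨
  (⁅ a ⁆ ∪ ⁅ b ⁆) ∪ ⁅ c ⁆ ≡⟨ cong (_∪ ⁅ c ⁆) (∪-comm ⁅ a ⁆ ⁅ b ⁆) ⟩
  (⁅ b ⁆ ∪ ⁅ a ⁆) ∪ ⁅ c ⁆ ≡⟨ ∪-assoc ⁅ b ⁆ ⁅ a ⁆ ⁅ c ⁆ ⟩
  ⁅ b ⁆ ∪ (⁅ a ⁆ ∪ ⁅ c ⁆) ∎
  where open ≡-Reasoning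

triple-swap₂₃ : ∀ {a b c} → triple a b c ≡ triple a c b
triple-swap₂₃ {a} {b} {c} = cong (⁅ a ⁆ ∪_) (∪-comm ⁅ b ⁆ ⁅ c ⁆)

module _ {a b c : Point} where

  ∈-triple₁ : a ∈ triple a b c
  ∈-triple₁ = x∈p∪q⁺ (inj₁ (x∈⁅x⁆ a))

  ∈-triple₂ : b ∈ triple a b c
  ∈-triple₂ = x∈p∪q⁺ (inj₂ (x∈p∪q⁺ (inj₁ (x∈⁅x⁆ b))))

  ∈-triple₃ : c ∈ triple a b c
  ∈-triple₃ = x∈p∪q⁺ (inj₂ (x∈p∪q⁺ (inj₂ (x∈⁅x⁆ c))))

  triple-front : ∀ {w} → w ∈ triple a b c → ∃₂ λ b′ c′ → triple a b c ≡ triple w b′ c′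
  triple-front = triple-elim (λ w → ∃₂ λ b′ c′ → triple a b c ≡ triple w b′ c′)
    (b , c , refl) (a , c , triple-swap₁₂) (a , b , trans triple-swap₂₃ triple-swap₁₂)

∣triple∣≡3⇒distinct : ∀ {a b c} → ∣ triple a b c ∣ ≡ 3 → a ≢ b × a ≢ c × b ≢ c
∣triple∣≡3⇒distinct {a} {b} {c} ∣abc∣≡3 =
    (λ { refl → size≤2 a c (collapse a c) ∣abc∣≡3 })
  , (λ { refl → size≤2 a b (trans triple-swap₂₃ (collapse a b)) ∣abc∣≡3 })
  , (λ { refl → size≤2 a b (cong (⁅ a ⁆ ∪_) (∪-idem ⁅ b ⁆)) ∣abc∣≡3 })
  where
  collapse : ∀ x y → triple x x y ≡ ⁅ x ⁆ ∪ ⁅ y ⁆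
  collapse x y = trans (sym (∪-assoc ⁅ x ⁆ ⁅ x ⁆ ⁅ y ⁆)) (cong (_∪ ⁅ y ⁆) (∪-idem ⁅ x ⁆))
  size≤2 : ∀ {T} x y → T ≡ ⁅ x ⁆ ∪ ⁅ y ⁆ → ∣ T ∣ ≢ 3
  size≤2 x y refl ∣T∣≡3 = ℕ.<-irrefl ∣T∣≡3 (s≤s (ℕ.≤-trans (∣p∪q∣≤∣p∣+∣q∣ ⁅ x ⁆ ⁅ y ⁆)
                                                (ℕ.≤-reflexive (cong₂ _+_ (∣⁅x⁆∣≡1 x) (∣⁅x⁆∣≡1 y)))))

∣T∣≡3⇒triple : ∀ {T : Subset 7} → ∣ T ∣ ≡ 3 → ∃ λ a → ∃₂ λ b c → T ≡ triple a b c
∣T∣≡3⇒triple {T} ∣T∣≡3 with ∣ T ∣ | ∣T∣≡3 | enumerate T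
... | _ | refl | a ∷ b ∷ c ∷ [] , T≡abc =
  a , b , c , trans T≡abc (cong (λ s → ⁅ a ⁆ ∪ (⁅ b ⁆ ∪ s)) (∪-identityʳ ⁅ c ⁆))

module _ (σ : Perm) (T : Subset 7) where

  ∈-image⁻ : ∀ {w} → w ∈ image σ T → σ ⟨$⟩ˡ w ∈ T
  ∈-image⁻ {w} w∈σT = lookup⇒[]= _ T (trans (sym (lookup∘tabulate (lookup T ∘ (σ ⟨$⟩ˡ_)) w)) ([]=⇒lookup w∈σT))

  ∈-image⁺ : ∀ {w} → σ ⟨$⟩ˡ w ∈ T → w ∈ image σ T
  ∈-image⁺ {w} σ⁻¹w∈T = lookup⇒[]= w _ (trans (lookup∘tabulate (lookup T ∘ (σ ⟨$⟩ˡ_)) w) ([]=⇒lookup σ⁻¹w∈T))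

image-triple : ∀ (σ : Perm) x y z → image σ (triple x y z) ≡ triple (σ ⟨$⟩ʳ x) (σ ⟨$⟩ʳ y) (σ ⟨$⟩ʳ z)
image-triple σ x y z = ⊆-antisym to from
  where
  σxyz = triple (σ ⟨$⟩ʳ x) (σ ⟨$⟩ʳ y) (σ ⟨$⟩ʳ z)
  to : image σ (triple x y z) ⊆ triple (σ ⟨$⟩ʳ x) (σ ⟨$⟩ʳ y) (σ ⟨$⟩ʳ z)
  to w∈ = subst (_∈ σxyz) (inverseʳ σ)
    (triple-elim (λ v → σ ⟨$⟩ʳ v ∈ σxyz) ∈-triple₁ ∈-triple₂ ∈-triple₃ (∈-image⁻ σ _ w∈))
  from : triple (σ ⟨$⟩ʳ x) (σ ⟨$⟩ʳ y) (σ ⟨$⟩ʳ z) ⊆ image σ (triple x y z)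
  from = triple-elim (_∈ image σ (triple x y z)) (back ∈-triple₁) (back ∈-triple₂) (back ∈-triple₃)
    where
    back : ∀ {v} → v ∈ triple x y z → σ ⟨$⟩ʳ v ∈ image σ (triple x y z)
    back v∈ = ∈-image⁺ σ _ (subst (_∈ triple x y z) (sym (inverseˡ σ)) v∈)

image-inverse : ∀ (σ ρ : Perm) T → (∀ w → σ ⟨$⟩ˡ (ρ ⟨$⟩ˡ w) ≡ w) → image ρ (image σ T) ≡ T
image-inverse σ ρ T inv =
  trans (tabulate-cong λ w → trans (lookup∘tabulate (lookup T ∘ (σ ⟨$⟩ˡ_)) (ρ ⟨$⟩ˡ w)) (cong (lookup T) (inv w)))
        (tabulate∘lookup T)

image-injective : ∀ (σ : Perm) {S T} → image σ S ≡ image σ T → S ≡ T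
image-injective σ {S} {T} σS≡σT = begin
  S                          ≡⟨ image-inverse σ (flip σ) S (λ _ → inverseˡ σ) ⟨
  image (flip σ) (image σ S) ≡⟨ cong (image (flip σ)) σS≡σT ⟩
  image (flip σ) (image σ T) ≡⟨ image-inverse σ (flip σ) T (λ _ → inverseˡ σ) ⟩
  T                          ∎
  where open ≡-Reasoning

image-∘ : ∀ (ρ τ : Perm) T → image (ρ ∘ₚ τ) T ≡ image τ (image ρ T)
image-∘ ρ τ T = tabulate-cong λ w → sym (lookup∘tabulate (lookup T ∘ (ρ ⟨$⟩ˡ_)) (τ ⟨$⟩ˡ w))

MapsBlocks : (Subset 7 → Set) → (Subset 7 → Set) → Perm → Set
MapsBlocks 𝔅₁ 𝔅₂ σ = ∀ T → 𝔅₁ T ⇔ 𝔅₂ (image σ T)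

record IsIso (𝔅₁ : Subset 7 → Set) (R₁ : Point → Point → Set) (𝔅₂ : Subset 7 → Set) (R₂ : Point → Point → Set)
             (σ : Perm) : Set where
  constructor mk-iso
  field
    maps-blocks      : MapsBlocks 𝔅₁ 𝔅₂ σ
    maps-orientation : MapsOrientation σ R₁ R₂

module _ {𝔅₁ 𝔅₂ : Subset 7 → Set} {R₁ R₂ : Point → Point → Set} where

  iso-∘ : ∀ {𝔅₃ R₃} ρ τ → IsIso 𝔅₁ R₁ 𝔅₂ R₂ ρ → IsIso 𝔅₂ R₂ 𝔅₃ R₃ τ → IsIso 𝔅₁ R₁ 𝔅₃ R₃ (ρ ∘ₚ τ)
  iso-∘ {𝔅₃} ρ τ (mk-iso ρ-blocks ρ-arrows) (mk-iso τ-blocks τ-arrows) = mk-iso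
    (λ T → subst (λ S → 𝔅₁ T ⇔ 𝔅₃ S) (sym (image-∘ ρ τ T)) (⇔.trans (ρ-blocks T) (τ-blocks (image ρ T))))
    (λ x y → ⇔.trans (ρ-arrows x y) (τ-arrows _ _))

  iso-flip : ∀ σ → IsIso 𝔅₁ R₁ 𝔅₂ R₂ σ → IsIso 𝔅₂ R₂ 𝔅₁ R₁ (flip σ)
  iso-flip σ (mk-iso σ-blocks σ-arrows) = mk-iso
    (λ T → ⇔.sym (subst (λ S → 𝔅₁ (image (flip σ) T) ⇔ 𝔅₂ S)
                        (image-inverse (flip σ) σ T (λ _ → inverseʳ σ)) (σ-blocks (image (flip σ) T))))
    (λ x y → ⇔.sym (subst₂ (λ u v → R₁ _ _ ⇔ R₂ u v) (inverseʳ σ) (inverseʳ σ) (σ-arrows _ _)))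

-- The standard oriented Fano plane

-- Label i is the nonzero vector of 𝔽₂³ whose binary digits spell i + 1; the lines are the
-- triples {u, v, u + v}.
std-lines : List (Subset 7)
std-lines = triple 0F 1F 2F ∷ triple 0F 3F 4F ∷ triple 0F 5F 6F ∷ triple 1F 3F 5F ∷
            triple 1F 4F 6F ∷ triple 2F 3F 6F ∷ triple 2F 4F 5F ∷ []

StdLine : Subset 7 → Set
StdLine T = T ∈ₗ std-lines

std-out : Fin 7 → Subset 7
std-out 0F = triple 1F 3F 5F
std-out 1F = triple 2F 3F 6F
std-out 2F = triple 0F 5F 6F
std-out 3F = triple 2F 4F 5F
std-out 4F = triple 0F 1F 2F
std-out 5F = triple 1F 4F 6F
std-out 6F = triple 0F 3F 4F

_↠_ : Fin 7 → Fin 7 → Set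
i ↠ j = j ∈ std-out i

-- Finite checks, decided by evaluation. They are opaque so that later conversion checks never
-- unfold them and re-run the decision procedures.
opaque
  std-covers : ∀ i j → i ≢ j → Any (λ B → i ∈ B × j ∈ B) std-lines
  std-covers = from-yes (all? λ i → all? λ j → ¬? (i ≟ j) →-dec any?ₗ (λ B → i ∈? B ×-dec j ∈? B) std-lines)

  std-tournament : ∀ i j → i ≢ j → i ↠ j ⊎ j ↠ i
  std-tournament = from-yes (all? λ i → all? λ j → ¬? (i ≟ j) →-dec (j ∈? std-out i ⊎-dec i ∈? std-out j))

  fourth-point : ∀ (a b c : Point) → ∃ λ w → w ≢ a × w ≢ b × w ≢ c
  fourth-point = from-yes (all? λ (a : Point) → all? λ (b : Point) → all? λ (c : Point) →
                           any? λ (w : Point) → ¬? (w ≟ a) ×-dec ¬? (w ≟ b) ×-dec ¬? (w ≟ c))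

-- The Steiner quasigroup of a Fano plane

module Fano (F : FanoPlane) where

  Line : Point → Point → Point → Set
  Line x y z = Block F (triple x y z)

  line-distinct : ∀ {x y z} → Line x y z → x ≢ y × x ≢ z × y ≢ z
  line-distinct ℓ = ∣triple∣≡3⇒distinct (block-size F _ ℓ)

  line-swap₁₂ : ∀ {x y z} → Line x y z → Line y x z
  line-swap₁₂ = subst (Block F) triple-swap₁₂

  line-swap₂₃ : ∀ {x y z} → Line x y z → Line x z y
  line-swap₂₃ = subst (Block F) triple-swap₂₃

  block-unique : ∀ {x y T T′} → x ≢ y → Block F T → Block F T′ →
                 x ∈ T → y ∈ T → x ∈ T′ → y ∈ T′ → T ≡ T′
  block-unique {x} {y} x≢y B B′ x∈T y∈T x∈T′ y∈T′ =
    let _ , _ , _ , _ , unique = pair-unique F x y x≢y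
    in trans (unique _ B x∈T y∈T) (sym (unique _ B′ x∈T′ y∈T′))

  line-unique : ∀ {x y z w} → Line x y z → Line x y w → z ≡ w
  line-unique {x} {y} {z} {w} ℓ ℓ′ = triple-elim (λ v → v ≡ w → z ≡ w)
      (λ x≡w → contradiction x≡w (proj₁ (proj₂ (line-distinct ℓ′))))
      (λ y≡w → contradiction y≡w (proj₂ (proj₂ (line-distinct ℓ′))))
      (λ z≡w → z≡w)
      (subst (w ∈_) (block-unique (proj₁ (line-distinct ℓ)) ℓ′ ℓ ∈-triple₁ ∈-triple₂ ∈-triple₁ ∈-triple₂) ∈-triple₃)
      refl

  line-through : ∀ {x y} → x ≢ y → ∃ λ z → Line x y z
  line-through {x} {y} x≢y
    with T , B , x∈T , y∈T , _ ← pair-unique F x y x≢y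
    with a , b , c , refl ← ∣T∣≡3⇒triple {T} (block-size F T B)
    with b′ , c′ , abc≡xb′c′ ← triple-front x∈T =
    triple-elim (λ v → v ≡ y → ∃ λ z → Line x y z)
      (λ x≡y → contradiction x≡y x≢y)
      (λ { refl → c′ , ℓ })
      (λ { refl → b′ , line-swap₂₃ ℓ })
      (subst (y ∈_) abc≡xb′c′ y∈T) refl
    where
    ℓ : Line x b′ c′
    ℓ = subst (Block F) abc≡xb′c′ B

  -- Setting x · x = x makes · a Steiner quasigroup, so the laws below hold without side conditions.
  infixl 30 _·_

  opaque
    _·_ : Point → Point → Point
    x · y with x ≟ y
    ... | yes _   = x
    ... | no  x≢y = proj₁ (line-through x≢y)

    ·-idem : ∀ x → x · x ≡ x
    ·-idem x with x ≟ x
    ... | yes _   = refl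
    ... | no  x≢x = contradiction refl x≢x

    ·-line : ∀ {x y} → x ≢ y → Line x y (x · y)
    ·-line {x} {y} x≢y with x ≟ y
    ... | yes x≡y = contradiction x≡y x≢y
    ... | no  x≢y = proj₂ (line-through x≢y)

  ·-unique : ∀ {x y z} → Line x y z → x · y ≡ z
  ·-unique ℓ = line-unique (·-line (proj₁ (line-distinct ℓ))) ℓ

  ·≢ˡ : ∀ {x y} → x ≢ y → x · y ≢ x
  ·≢ˡ x≢y = ≢-sym (proj₁ (proj₂ (line-distinct (·-line x≢y))))

  ·≢ʳ : ∀ {x y} → x ≢ y → x · y ≢ y
  ·≢ʳ x≢y = ≢-sym (proj₂ (proj₂ (line-distinct (·-line x≢y))))

  ·-comm : ∀ x y → x · y ≡ y · x
  ·-comm x y with x ≟ y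
  ... | yes refl = refl
  ... | no  x≢y  = sym (·-unique (line-swap₁₂ (·-line x≢y)))

  ·-involutive : ∀ x y → x · (x · y) ≡ y
  ·-involutive x y with x ≟ y
  ... | yes refl = trans (cong (x ·_) (·-idem x)) (·-idem x)
  ... | no  x≢y  = ·-unique (line-swap₂₃ (·-line x≢y))

  ·-involutiveʳ : ∀ x y → (x · y) · y ≡ x
  ·-involutiveʳ x y = trans (·-comm (x · y) y) (trans (cong (y ·_) (·-comm x y)) (·-involutive y x))

  ·-exchange : ∀ {x y z} → x · y ≡ z → x · z ≡ y
  ·-exchange {x} {y} refl = ·-involutive x y

  ·-cancelˡ : ∀ {x y z} → x · y ≡ x · z → y ≡ z
  ·-cancelˡ {x} {y} {z} eq = trans (sym (·-involutive x y)) (trans (cong (x ·_) eq) (·-involutive x z))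

  ·-cancelʳ : ∀ {x y z} → y · x ≡ z · x → y ≡ z
  ·-cancelʳ {x} {y} {z} eq = ·-cancelˡ (trans (·-comm x y) (trans eq (·-comm z x)))

  lines-apart : ∀ {x r s} → s ≢ r → s ≢ x · r → r ≢ s × r ≢ x · s × x · r ≢ x · s
  lines-apart s≢r s≢xr = ≢-sym s≢r , (λ r≡xs → s≢xr (sym (·-exchange (sym r≡xs)))) , s≢r ∘ sym ∘ ·-cancelˡ

  lines-through-differ : ∀ {x r s} → x ≢ s → s ≢ r → s ≢ x · r → triple x r (x · r) ≢ triple x s (x · s)
  lines-through-differ {x} {r} {s} x≢s s≢r s≢xr eq =
    triple-elim (_≢ s) x≢s (≢-sym s≢r) (≢-sym s≢xr) (subst (s ∈_) (sym eq) ∈-triple₂) refl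

  pencil-unique : ∀ {x r₁ r₂ r₃} → x ≢ r₁ → x ≢ r₂ → x ≢ r₃ →
                  r₂ ≢ r₁ → r₂ ≢ x · r₁ → r₃ ≢ r₁ → r₃ ≢ x · r₁ → r₃ ≢ r₂ → r₃ ≢ x · r₂ →
                  Unique (x ∷ r₁ ∷ x · r₁ ∷ r₂ ∷ x · r₂ ∷ r₃ ∷ x · r₃ ∷ [])
  pencil-unique {x} x≢r₁ x≢r₂ x≢r₃ r₂≢r₁ r₂≢xr₁ r₃≢r₁ r₃≢xr₁ r₃≢r₂ r₃≢xr₂
    with r₁≢r₂ , r₁≢xr₂ , xr₁≢xr₂ ← lines-apart r₂≢r₁ r₂≢xr₁
    with r₁≢r₃ , r₁≢xr₃ , xr₁≢xr₃ ← lines-apart r₃≢r₁ r₃≢xr₁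
    with r₂≢r₃ , r₂≢xr₃ , xr₂≢xr₃ ← lines-apart r₃≢r₂ r₃≢xr₂ =
      (x≢r₁ ∷ x≢x· x≢r₁ ∷ x≢r₂ ∷ x≢x· x≢r₂ ∷ x≢r₃ ∷ x≢x· x≢r₃ ∷ []) ∷
      (r≢x· x≢r₁ ∷ r₁≢r₂ ∷ r₁≢xr₂ ∷ r₁≢r₃ ∷ r₁≢xr₃ ∷ []) ∷
      (≢-sym r₂≢xr₁ ∷ xr₁≢xr₂ ∷ ≢-sym r₃≢xr₁ ∷ xr₁≢xr₃ ∷ []) ∷
      (r≢x· x≢r₂ ∷ r₂≢r₃ ∷ r₂≢xr₃ ∷ []) ∷
      (≢-sym r₃≢xr₂ ∷ xr₂≢xr₃ ∷ []) ∷
      (r≢x· x≢r₃ ∷ []) ∷ [] ∷ []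
    where
    x≢x· : ∀ {r} → x ≢ r → x ≢ x · r
    x≢x· x≢r = ≢-sym (·≢ˡ x≢r)
    r≢x· : ∀ {r} → x ≢ r → r ≢ x · r
    r≢x· x≢r = ≢-sym (·≢ʳ x≢r)

  -- Coordinates from a triangle

  record Triangle (x y z : Point) : Set where
    field
      x≢y   : x ≢ y
      z≢x   : z ≢ x
      z≢y   : z ≢ y
      z≢x·y : z ≢ x · y

  triangle-swap : ∀ {x y z} → Triangle x y z → Triangle x z y
  triangle-swap t = record
    { x≢y = ≢-sym z≢x ; z≢x = ≢-sym x≢y ; z≢y = ≢-sym z≢y ; z≢x·y = proj₁ (proj₂ (lines-apart z≢y z≢x·y)) }
    where open Triangle t

  triangle-· : ∀ {x y z} → Triangle x y z → Triangle x y (x · z)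
  triangle-· t = record
    { x≢y = x≢y ; z≢x = ·≢ˡ (≢-sym z≢x)
    ; z≢y = ≢-sym (proj₁ (proj₂ (lines-apart z≢y z≢x·y))) ; z≢x·y = ≢-sym (proj₂ (proj₂ (lines-apart z≢y z≢x·y))) }
    where open Triangle t

  module Labelling {x y z} (t : Triangle x y z) where
    open Triangle t

    points : Vec Point 7
    points = x ∷ y ∷ x · y ∷ z ∷ x · z ∷ y · z ∷ x · (y · z) ∷ []

    points-unique : Unique points
    points-unique = pencil-unique x≢y (≢-sym z≢x) (≢-sym yz≢x) z≢y z≢x·y yz≢y yz≢xy yz≢z yz≢xz
      where
      yz≢x : y · z ≢ x
      yz≢x yz≡x = z≢x·y (trans (sym (·-exchange yz≡x)) (·-comm y x))
      yz≢y : y · z ≢ y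
      yz≢y = ·≢ˡ (≢-sym z≢y)
      yz≢xy : y · z ≢ x · y
      yz≢xy yz≡xy = z≢x (·-cancelˡ (trans yz≡xy (·-comm x y)))
      yz≢z : y · z ≢ z
      yz≢z = ·≢ʳ (≢-sym z≢y)
      yz≢xz : y · z ≢ x · z
      yz≢xz yz≡xz = x≢y (sym (·-cancelʳ yz≡xz))

    label : Fin 7 → Point
    label = lookup points

    label-injective : Injective _≡_ _≡_ label
    label-injective = lookup-injective points-unique _ _

    distinct : ∀ i j → {False (i ≟ j)} → label i ≢ label j
    distinct i j {i≢j} = toWitnessFalse i≢j ∘ label-injective

    covers : ∀ w → ∃ λ i → label i ≡ w
    covers = injective⇒surjective label-injective

    labelling : Perm
    labelling = permutation label (proj₁ ∘ covers) (proj₂ ∘ covers)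
                            (λ i → label-injective (proj₂ (covers (label i))))

    -- (x · y) · z is one of the seven labelled points, and cancellation rules out all but the last.
    assoc : (x · y) · z ≡ x · (y · z)
    assoc with covers ((x · y) · z)
    ... | 0F , x≡xy·z  = ⊥-elim (distinct 1F 3F (trans (sym (·-involutiveʳ y x))
                                                      (trans (cong (_· x) (·-comm y x)) (·-exchange (sym x≡xy·z)))))
    ... | 1F , y≡xy·z  = ⊥-elim (distinct 0F 3F (trans (sym (·-involutiveʳ x y)) (·-exchange (sym y≡xy·z))))
    ... | 2F , xy≡xy·z = ⊥-elim (·≢ˡ (≢-sym z≢x·y) (sym xy≡xy·z))
    ... | 3F , z≡xy·z  = ⊥-elim (·≢ʳ (≢-sym z≢x·y) (sym z≡xy·z))
    ... | 4F , xz≡xy·z = ⊥-elim (distinct 0F 2F (sym (·-cancelʳ (sym xz≡xy·z))))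
    ... | 5F , yz≡xy·z = ⊥-elim (distinct 1F 2F (sym (·-cancelʳ (sym yz≡xy·z))))
    ... | 6F , e≡xy·z  = sym e≡xy·z

  ·-assoc : ∀ {x y z} → Triangle x y z → (x · y) · z ≡ x · (y · z)
  ·-assoc t = Labelling.assoc t

  block-pair : ∀ {T} → Block F T → ∃₂ λ a b → a ≢ b × a ∈ T × b ∈ T
  block-pair {T} B with a , b , c , T≡abc ← ∣T∣≡3⇒triple {T} (block-size F T B) =
    a , b , proj₁ (line-distinct (subst (Block F) T≡abc B)) ,
    subst (a ∈_) (sym T≡abc) ∈-triple₁ , subst (b ∈_) (sym T≡abc) ∈-triple₂

  maps-std-lines⇒maps-blocks : ∀ P → All (λ B → Block F (image P B)) std-lines → MapsBlocks StdLine (Block F) P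
  maps-std-lines⇒maps-blocks P std-blocks T = mk⇔ (All.lookup std-blocks) from-block
    where
    through-pair : ∀ {a b} → a ≢ b → a ∈ image P T → b ∈ image P T → Block F (image P T) → StdLine T
    through-pair {a} {b} a≢b a∈ b∈ B =
      let C , C∈std , i∈C , j∈C = find (std-covers (P ⟨$⟩ˡ a) (P ⟨$⟩ˡ b) i≢j)
          PT≡PC = block-unique a≢b B (All.lookup std-blocks C∈std) a∈ b∈ (∈-image⁺ P C i∈C) (∈-image⁺ P C j∈C)
      in subst StdLine (sym (image-injective P PT≡PC)) C∈std
      where
      i≢j : P ⟨$⟩ˡ a ≢ P ⟨$⟩ˡ b
      i≢j i≡j = a≢b (trans (sym (inverseʳ P)) (trans (cong (P ⟨$⟩ʳ_) i≡j) (inverseʳ P)))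
    from-block : Block F (image P T) → StdLine T
    from-block B = let a , b , a≢b , a∈ , b∈ = block-pair B in through-pair a≢b a∈ b∈ B

  module Frame {x y z} (t : Triangle x y z) where
    open Triangle t
    open Labelling t public using (label; distinct; labelling)

    frame-lines : All (λ B → Block F (image labelling B)) std-lines
    frame-lines = from-line 0F 1F 2F (·-line x≢y) ∷ from-line 0F 3F 4F (·-line (≢-sym z≢x)) ∷
                  from-line 0F 5F 6F (·-line (distinct 0F 5F)) ∷ from-line 1F 3F 5F (·-line (≢-sym z≢y)) ∷
                  from-line 1F 4F 6F ℓ₁₄₆ ∷ from-line 2F 3F 6F ℓ₂₃₆ ∷ from-line 2F 4F 5F ℓ₂₄₅ ∷ []
      where
      from-line : ∀ i j k → Line (label i) (label j) (label k) → Block F (image labelling (triple i j k))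
      from-line i j k = subst (Block F) (sym (image-triple labelling i j k))
      ℓ₁₄₆ : Line y (x · z) (x · (y · z))
      ℓ₁₄₆ = subst (Line y (x · z)) y·xz≡x·yz (·-line (distinct 1F 4F))
        where
        xzy : Triangle x z y
        xzy = record { x≢y = distinct 0F 3F ; z≢x = distinct 1F 0F ; z≢y = distinct 1F 3F ; z≢x·y = distinct 1F 4F }
        y·xz≡x·yz : y · (x · z) ≡ x · (y · z)
        y·xz≡x·yz = begin
          y · (x · z) ≡⟨ ·-comm y (x · z) ⟩
          (x · z) · y ≡⟨ ·-assoc xzy ⟩
          x · (z · y) ≡⟨ cong (x ·_) (·-comm z y) ⟩
          x · (y · z) ∎
          where open ≡-Reasoning
      ℓ₂₃₆ : Line (x · y) z (x · (y · z))
      ℓ₂₃₆ = subst (Line (x · y) z) (·-assoc t) (·-line (distinct 2F 3F))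
      ℓ₂₄₅ : Line (x · y) (x · z) (y · z)
      ℓ₂₄₅ = line-swap₂₃ (subst (Line (x · y) (y · z)) xy·yz≡xz (·-line (distinct 2F 5F)))
        where
        x-y-yz : Triangle x y (y · z)
        x-y-yz = record { x≢y = x≢y ; z≢x = distinct 5F 0F ; z≢y = distinct 5F 1F ; z≢x·y = distinct 5F 2F }
        xy·yz≡xz : (x · y) · (y · z) ≡ x · z
        xy·yz≡xz = trans (·-assoc x-y-yz) (cong (x ·_) (·-involutive y z))

    frame-line : ∀ i j k → {True (triple i j k ∈ₗ? std-lines)} → Line (label i) (label j) (label k)
    frame-line i j k {ijk∈std} =
      subst (Block F) (image-triple labelling i j k) (All.lookup frame-lines (toWitness ijk∈std))

    frame-maps-blocks : MapsBlocks StdLine (Block F) labelling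
    frame-maps-blocks = maps-std-lines⇒maps-blocks labelling frame-lines

module Oriented (F : FanoPlane) {_⟶_ : Point → Point → Set} (O : IsOrientation F _⟶_) where
  open Fano F
  open IsOrientation O

  ⟶⇒≢ : ∀ {x y} → x ⟶ y → x ≢ y
  ⟶⇒≢ {x} x⟶y refl = antisym x x x⟶y x⟶y

  ⟶-next : ∀ {x y z} → Line x y z → x ⟶ y → y ⟶ z
  ⟶-next {x} {y} {z} ℓ x⟶y with cyclic x y z ℓ
  ... | inj₁ (_ , y⟶z , _) = y⟶z
  ... | inj₂ (_ , _ , y⟶x) = contradiction y⟶x (antisym x y x⟶y)

  ⟶-prev : ∀ {x y z} → Line x y z → x ⟶ y → z ⟶ x
  ⟶-prev {x} {y} {z} ℓ x⟶y with cyclic x y z ℓ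
  ... | inj₁ (_ , _ , z⟶x) = z⟶x
  ... | inj₂ (_ , _ , y⟶x) = contradiction y⟶x (antisym x y x⟶y)

  ⟶-total : ∀ {x y} → x ≢ y → x ⟶ y ⊎ y ⟶ x
  ⟶-total {x} {y} x≢y with cyclic x y (x · y) (·-line x≢y)
  ... | inj₁ (x⟶y , _) = inj₁ x⟶y
  ... | inj₂ (_ , _ , y⟶x) = inj₂ y⟶x

  ⟶-on-line : ∀ {x w} → x ≢ w → x ⟶ w ⊎ x ⟶ x · w
  ⟶-on-line {x} {w} x≢w with ⟶-total x≢w
  ... | inj₁ x⟶w = inj₁ x⟶w
  ... | inj₂ w⟶x = inj₂ (⟶-next (line-swap₁₂ (·-line x≢w)) w⟶x)

  -- Were y · z ⟶ x, then u = x · (y · z) would be a third out-neighbour of x, off the lines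
  -- through x and y, x and z; by property (ii) u would lie on the line y z (y · z), i.e. u = y · z.
  ⟶-closed· : ∀ {x y z} → y ≢ z → z ≢ x · y → x ⟶ y → x ⟶ z → x ⟶ y · z
  ⟶-closed· {x} {y} {z} y≢z z≢xy x⟶y x⟶z = by-cases (⟶-total x≢yz)
    where
    x≢y = ⟶⇒≢ x⟶y
    x≢z = ⟶⇒≢ x⟶z
    x≢yz : x ≢ y · z
    x≢yz x≡yz = z≢xy (trans (sym (·-exchange (sym x≡yz))) (·-comm y x))
    by-cases : x ⟶ y · z ⊎ y · z ⟶ x → x ⟶ y · z
    by-cases (inj₁ x⟶yz) = x⟶yz
    by-cases (inj₂ yz⟶x) = contradiction (·-unique y-z-u) (≢-sym (·≢ʳ x≢yz))
      where
      u = x · (y · z)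
      x⟶u : x ⟶ u
      x⟶u = ⟶-next (line-swap₁₂ (·-line x≢yz)) yz⟶x
      x≢u = ⟶⇒≢ x⟶u
      u≢y : u ≢ y
      u≢y u≡y = x≢z (·-cancelˡ (trans (·-comm y x) (·-exchange u≡y)))
      u≢xy : u ≢ x · y
      u≢xy u≡xy = ·≢ˡ y≢z (·-cancelˡ u≡xy)
      u≢z : u ≢ z
      u≢z u≡z = x≢y (·-cancelʳ (·-exchange u≡z))
      u≢xz : u ≢ x · z
      u≢xz u≡xz = ·≢ʳ y≢z (·-cancelˡ u≡xz)
      y-z-u : Line y z u
      y-z-u = out-block x y (x · y) z (x · z) u (x · u) (·-line x≢y) (·-line x≢z) (·-line x≢u)
        (lines-through-differ x≢z (≢-sym y≢z) z≢xy) (lines-through-differ x≢u u≢y u≢xy)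
        (lines-through-differ x≢u u≢z u≢xz) x⟶y x⟶z x⟶u

  ⟶-closed : ∀ {x y z w v} → Line x y w → Line y z v → z ≢ w → x ⟶ y → x ⟶ z → x ⟶ v
  ⟶-closed xyw yzv z≢w x⟶y x⟶z = subst (_ ⟶_) (·-unique yzv)
    (⟶-closed· (proj₁ (line-distinct yzv)) (subst (_ ≢_) (sym (·-unique xyw)) z≢w) x⟶y x⟶z)

  record Seed (x y z : Point) : Set where
    field
      triangle : Triangle x y z
      x⟶y : x ⟶ y
      x⟶z : x ⟶ z
      y⟶z : y ⟶ z

  seed-from-triangle : ∀ {x y z} → Triangle x y z → x ⟶ y → x ⟶ z → ∃₂ λ y′ z′ → Seed x y′ z′
  seed-from-triangle t x⟶y x⟶z with ⟶-total (≢-sym (Triangle.z≢y t))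
  ... | inj₁ y⟶z = _ , _ , record { triangle = t ; x⟶y = x⟶y ; x⟶z = x⟶z ; y⟶z = y⟶z }
  ... | inj₂ z⟶y = _ , _ , record { triangle = triangle-swap t ; x⟶y = x⟶z ; x⟶z = x⟶y ; y⟶z = z⟶y }

  seed-from-arrow : ∀ {x y} → x ⟶ y → ∃₂ λ y′ z′ → Seed x y′ z′
  seed-from-arrow {x} {y} x⟶y =
    let z , z≢x , z≢y , z≢xy = fourth-point x y (x · y)
        t : Triangle x y z
        t = record { x≢y = ⟶⇒≢ x⟶y ; z≢x = z≢x ; z≢y = z≢y ; z≢x·y = z≢xy }
    in [ seed-from-triangle t x⟶y , seed-from-triangle (triangle-· t) x⟶y ]′ (⟶-on-line (≢-sym z≢x))

  seed : ∃ λ x → ∃₂ λ y z → Seed x y z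
  seed = 0F , [ seed-from-arrow , seed-from-arrow ]′ (⟶-on-line {0F} {1F} λ ())

  module SeededFrame {x y z} (s : Seed x y z) where
    open Seed s
    open Frame triangle

    _⇀_ : Fin 7 → Fin 7 → Set
    i ⇀ j = label i ⟶ label j

    -- The seed gives one arrow on each of the lines 012, 034, 135; ⟶-closed gives one on each
    -- of the remaining lines, and ⟶-next, ⟶-prev complete every line.
    r01 : 0F ⇀ 1F
    r01 = x⟶y
    r03 : 0F ⇀ 3F
    r03 = x⟶z
    r13 : 1F ⇀ 3F
    r13 = y⟶z
    r05 : 0F ⇀ 5F
    r05 = ⟶-closed (frame-line 0F 1F 2F) (frame-line 1F 3F 5F) (distinct 3F 2F) r01 r03
    r12 : 1F ⇀ 2F
    r12 = ⟶-next (frame-line 0F 1F 2F) r01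
    r20 : 2F ⇀ 0F
    r20 = ⟶-prev (frame-line 0F 1F 2F) r01
    r34 : 3F ⇀ 4F
    r34 = ⟶-next (frame-line 0F 3F 4F) r03
    r40 : 4F ⇀ 0F
    r40 = ⟶-prev (frame-line 0F 3F 4F) r03
    r35 : 3F ⇀ 5F
    r35 = ⟶-next (frame-line 1F 3F 5F) r13
    r51 : 5F ⇀ 1F
    r51 = ⟶-prev (frame-line 1F 3F 5F) r13
    r56 : 5F ⇀ 6F
    r56 = ⟶-next (frame-line 0F 5F 6F) r05
    r60 : 6F ⇀ 0F
    r60 = ⟶-prev (frame-line 0F 5F 6F) r05
    r16 : 1F ⇀ 6F
    r16 = ⟶-closed (frame-line 1F 2F 0F) (frame-line 2F 3F 6F) (distinct 3F 0F) r12 r13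
    r64 : 6F ⇀ 4F
    r64 = ⟶-next (frame-line 1F 6F 4F) r16
    r41 : 4F ⇀ 1F
    r41 = ⟶-prev (frame-line 1F 6F 4F) r16
    r32 : 3F ⇀ 2F
    r32 = ⟶-closed (frame-line 3F 4F 0F) (frame-line 4F 5F 2F) (distinct 5F 0F) r34 r35
    r26 : 2F ⇀ 6F
    r26 = ⟶-next (frame-line 3F 2F 6F) r32
    r63 : 6F ⇀ 3F
    r63 = ⟶-prev (frame-line 3F 2F 6F) r32
    r25 : 2F ⇀ 5F
    r25 = ⟶-closed (frame-line 2F 0F 1F) (frame-line 0F 6F 5F) (distinct 6F 1F) r20 r26
    r54 : 5F ⇀ 4F
    r54 = ⟶-next (frame-line 2F 5F 4F) r25
    r42 : 4F ⇀ 2F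
    r42 = ⟶-prev (frame-line 2F 5F 4F) r25

    out : ∀ i a b c → i ⇀ a → i ⇀ b → i ⇀ c → ∀ {j} → j ∈ triple a b c → i ⇀ j
    out i a b c ia ib ic = triple-elim (i ⇀_) ia ib ic

    arrows : ∀ i {j} → i ↠ j → i ⇀ j
    arrows 0F = out 0F 1F 3F 5F r01 r03 r05
    arrows 1F = out 1F 2F 3F 6F r12 r13 r16
    arrows 2F = out 2F 0F 5F 6F r20 r25 r26
    arrows 3F = out 3F 2F 4F 5F r32 r34 r35
    arrows 4F = out 4F 0F 1F 2F r40 r41 r42
    arrows 5F = out 5F 1F 4F 6F r51 r54 r56
    arrows 6F = out 6F 0F 3F 4F r60 r63 r64

    frame-maps-orientation : MapsOrientation labelling _↠_ _⟶_
    frame-maps-orientation i j = mk⇔ (arrows i) from-arrow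
      where
      from-arrow : i ⇀ j → i ↠ j
      from-arrow i⇀j with std-tournament i j (⟶⇒≢ i⇀j ∘ cong label)
      ... | inj₁ i↠j = i↠j
      ... | inj₂ j↠i = contradiction (arrows j j↠i) (antisym _ _ i⇀j)

  standard-iso : ∃ λ P → IsIso StdLine _↠_ (Block F) _⟶_ P
  standard-iso =
    let _ , _ , _ , s = seed
    in Frame.labelling (Seed.triangle s)
     , mk-iso (Frame.frame-maps-blocks (Seed.triangle s)) (SeededFrame.frame-maps-orientation s)

conjugation-iso : ∀ F {R₁ R₂} σ → IsIso (Block F) R₁ (Block F) R₂ σ → AutGroupsIsomorphic F R₁ R₂
conjugation-iso F {R₁} {R₂} σ σ-iso = φ , φ-cong , φ-aut , φ-hom , φ-injective , φ-surjective
  where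
  φ : Perm → Perm
  φ ρ = flip σ ∘ₚ ρ ∘ₚ σ
  φ-cong : ∀ ρ τ → ρ ≈ₚ τ → φ ρ ≈ₚ φ τ
  φ-cong ρ τ ρ≈τ x = cong (σ ⟨$⟩ʳ_) (ρ≈τ (σ ⟨$⟩ˡ x))
  φ-aut : ∀ ρ → IsOrientedAut F R₁ ρ → IsOrientedAut F R₂ (φ ρ)
  φ-aut ρ (ρ-aut , ρ-arrows) = maps-blocks , maps-orientation
    where open IsIso (iso-∘ (flip σ) (ρ ∘ₚ σ) (iso-flip σ σ-iso) (iso-∘ ρ σ (mk-iso ρ-aut ρ-arrows) σ-iso))
  φ-hom : ∀ ρ τ → IsOrientedAut F R₁ ρ → IsOrientedAut F R₁ τ → φ (ρ ∘ₚ τ) ≈ₚ (φ ρ ∘ₚ φ τ)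
  φ-hom ρ τ _ _ x = cong (λ w → σ ⟨$⟩ʳ (τ ⟨$⟩ʳ w)) (sym (inverseˡ σ))
  φ-injective : ∀ ρ τ → IsOrientedAut F R₁ ρ → IsOrientedAut F R₁ τ → φ ρ ≈ₚ φ τ → ρ ≈ₚ τ
  φ-injective ρ τ _ _ φρ≈φτ x = begin
    ρ ⟨$⟩ʳ x                                  ≡⟨ cong (ρ ⟨$⟩ʳ_) (inverseˡ σ) ⟨
    ρ ⟨$⟩ʳ (σ ⟨$⟩ˡ (σ ⟨$⟩ʳ x))                ≡⟨ inverseˡ σ ⟨
    σ ⟨$⟩ˡ (φ ρ ⟨$⟩ʳ (σ ⟨$⟩ʳ x))              ≡⟨ cong (σ ⟨$⟩ˡ_) (φρ≈φτ (σ ⟨$⟩ʳ x)) ⟩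
    σ ⟨$⟩ˡ (φ τ ⟨$⟩ʳ (σ ⟨$⟩ʳ x))              ≡⟨ inverseˡ σ ⟩
    τ ⟨$⟩ʳ (σ ⟨$⟩ˡ (σ ⟨$⟩ʳ x))                ≡⟨ cong (τ ⟨$⟩ʳ_) (inverseˡ σ) ⟩
    τ ⟨$⟩ʳ x                                  ∎
    where open ≡-Reasoning
  φ-surjective : ∀ ρ → IsOrientedAut F R₂ ρ → Σ Perm λ ρ′ → IsOrientedAut F R₁ ρ′ × φ ρ′ ≈ₚ ρ
  φ-surjective ρ (ρ-aut , ρ-arrows) =
    σ ∘ₚ ρ ∘ₚ flip σ , (maps-blocks , maps-orientation) , λ x → trans (inverseʳ σ) (cong (ρ ⟨$⟩ʳ_) (inverseʳ σ))
    where open IsIso (iso-∘ σ (ρ ∘ₚ flip σ) σ-iso (iso-∘ ρ (flip σ) (mk-iso ρ-aut ρ-arrows) (iso-flip σ σ-iso)))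

corollary3p4 : (F : FanoPlane) (_⟶₁_ _⟶₂_ : Point → Point → Set) →
    IsOrientation F _⟶₁_ → IsOrientation F _⟶₂_ →
    (Σ Perm λ σ → IsAut F σ × MapsOrientation σ _⟶₁_ _⟶₂_)
    × AutGroupsIsomorphic F _⟶₁_ _⟶₂_
corollary3p4 F _ _ O₁ O₂ =
  (σ , IsIso.maps-blocks σ-iso , IsIso.maps-orientation σ-iso) , conjugation-iso F σ σ-iso
  where
  P₁ = Oriented.standard-iso F O₁
  P₂ = Oriented.standard-iso F O₂
  σ : Perm
  σ = flip (proj₁ P₁) ∘ₚ proj₁ P₂
  σ-iso : IsIso (Block F) _ (Block F) _ σ
  σ-iso = iso-∘ (flip (proj₁ P₁)) (proj₁ P₂) (iso-flip (proj₁ P₁) (proj₂ P₁)) (proj₂ P₂)
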